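{- Let $p$ be a prime, $n\ge1$ an integer, $b=p^n$, and let $t\ge0$, $s\ge1$ be integers. Write the base-$b$ expansion of $\vartheta(p^n)$ as $\vartheta(p^n)=\sum_{i\ge1}d_ib^{ -i}$ with digits $0\le d_i<b$ not eventually all $0$. Then $d_{t+i}=d_{t+i+s}$ for all $i\ge1$ (i.e. $\vartheta(p^n)=\{0.d_1\cdots d_t\overline{d_{t+1}\cdots d_{t+s}}\}_b$) if and only if $$\frac{p^{nt}}{n}\sum_{i=0}^{sn-1}p^i\in\mathbb{Z}.$$
   Context: $Z_b(m)$ is the number of trailing zeroes in the base-$b$ expansion of $m!$. $\vartheta(b):=\lim_{m\to\infty}Z_b(m)/m$; in particular $\vartheta(p^n)=\frac{1}{n(p-1)}$. -}

module Defs where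

open import Data.Nat using (ℕ; zero; suc; _+_; _*_; _∸_; _^_; _≤_; _<_)
open import Data.Product using (_×_; ∃-syntax)
open import Relation.Binary.PropositionalEquality using (_≢_)

-- Digit sequences are functions d : ℕ → ℕ; only positions i ≥ 1 are used
-- (d 0 is ignored), d i being the i-th digit after the radix point.

-- Scaled partial sum: partial b d k = Σ_{i=1}^{k} d i * b^(k-i),
-- i.e. (Σ_{i=1}^{k} d_i b^{-i}) * b^k.
partial : ℕ → (ℕ → ℕ) → ℕ → ℕ
partial b d zero    = 0
partial b d (suc k) = partial b d k * b + d (suc k)

-- With digits < b the partial sums P_k increase and the tail after k is
-- at most b^{-k}, so the series equals num/den iff for every k
--   P_k ≤ num/den ≤ P_k + b^{-k},
-- which, after multiplying by den * b^k, is the condition below.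
SeriesEquals : ℕ → (ℕ → ℕ) → ℕ → ℕ → Set
SeriesEquals b d num den =
  ∀ k → (partial b d k * den ≤ num * b ^ k)
      × (num * b ^ k ≤ (partial b d k + 1) * den)

IsBaseExpansion : ℕ → ℕ → ℕ → (ℕ → ℕ) → Set
IsBaseExpansion b num den d =
  (∀ i → d i < b)
  × (∀ K → ∃[ i ] (K < i × d i ≢ 0))
  × SeriesEquals b d num den

-- ϑ(p^n) = 1 / (n (p - 1)) : numerator and denominator.
θnum : ℕ → ℕ → ℕ
θnum p n = 1

θden : ℕ → ℕ → ℕ
θden p n = n * (p ∸ 1)

geomSum : ℕ → ℕ → ℕ
geomSum p zero    = 0
geomSum p (suc m) = geomSum p m + p ^ m

module Submission where

-- The proof runs the long division of num / D in base b.  With P k the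
-- scaled partial sum of the first k digits, the remainders
--   r k = num * b^k - P k * D
-- satisfy 1 ≤ r k ≤ D (the expansion never terminates) and the division
-- step r (k+1) + d (k+1) * D = b * r k.  By uniqueness of Euclidean
-- division the remainder r k determines every later digit and, conversely,
-- because D < b^D the tail of digits after position k determines r k.
-- Hence the digits are periodic from t with period s iff r t = r (t + s).
-- Comparing the two decompositions of num * b^(t+s), this holds iff
-- D ∣ num * b^t * (b^s - 1).  For b = p^n, num = 1, D = n (p - 1) we have
-- b^s - 1 = (p - 1) * Σ_{i<sn} p^i, and cancelling p - 1 yields lemma4.

open import Defs
open import Data.Nat using (ℕ; zero; suc; _+_; _*_; _∸_; _^_; _≤_; _<_; z≤n; s≤s; NonZero; 2+)
open import Data.Nat.Properties
open import Data.Nat.DivMod using (_%_; [m+kn]%n≡m%n; m<n⇒m%n≡m)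
open import Data.Nat.Divisibility using (_∣_; divides; ∣m+n∣m⇒∣n; n∣m*n; *-monoˡ-∣; *-cancelʳ-∣)
open import Data.Nat.Primality using (Prime; ¬prime[0]; ¬prime[1])
open import Data.Nat.Tactic.RingSolver using (solve-∀)
open import Data.Product using (_×_; _,_; proj₁; proj₂; ∃-syntax)
open import Data.Empty using (⊥-elim)
open import Function.Bundles using (_⇔_; mk⇔; Equivalence)
open import Function.Properties.Equivalence using () renaming (trans to ⇔-trans; sym to ⇔-sym)
open import Relation.Binary.PropositionalEquality
open ≡-Reasoning

euclid-unique : ∀ {B x₁ x₂ a₁ a₂} .{{_ : NonZero B}} → x₁ < B → x₂ < B →
  x₁ + a₁ * B ≡ x₂ + a₂ * B → x₁ ≡ x₂ × a₁ ≡ a₂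
euclid-unique {B} {x₁} {x₂} {a₁} {a₂} x₁<B x₂<B eq = x₁≡x₂ , a₁≡a₂
  where
  x₁≡x₂ : x₁ ≡ x₂
  x₁≡x₂ = begin
    x₁                ≡⟨ sym (m<n⇒m%n≡m x₁<B) ⟩
    x₁ % B            ≡⟨ sym ([m+kn]%n≡m%n x₁ a₁ B) ⟩
    (x₁ + a₁ * B) % B ≡⟨ cong (_% B) eq ⟩
    (x₂ + a₂ * B) % B ≡⟨ [m+kn]%n≡m%n x₂ a₂ B ⟩
    x₂ % B            ≡⟨ m<n⇒m%n≡m x₂<B ⟩
    x₂                ∎
  a₁≡a₂ : a₁ ≡ a₂
  a₁≡a₂ = *-cancelʳ-≡ a₁ a₂ B (+-cancelˡ-≡ x₁ _ _ (trans eq (cong (_+ a₂ * B) (sym x₁≡x₂))))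

-- The same with remainders taken in 1 … D instead of 0 … D - 1, the range
-- of the remainders of a non-terminating long division.
division-unique : ∀ {D r₁ r₂ a₁ a₂} .{{_ : NonZero D}} → 1 ≤ r₁ → r₁ ≤ D → 1 ≤ r₂ → r₂ ≤ D →
  r₁ + a₁ * D ≡ r₂ + a₂ * D → r₁ ≡ r₂ × a₁ ≡ a₂
division-unique {r₁ = suc x₁} {suc x₂} _ r₁≤D _ r₂≤D eq
  with euclid-unique r₁≤D r₂≤D (suc-injective eq)
... | x₁≡x₂ , a₁≡a₂ = cong suc x₁≡x₂ , a₁≡a₂

-- If B * u₁ and B * u₂ exceed a common value C by at most D < B, then
-- u₁ = u₂: two distinct multiples of B are at least B apart.
close-multiples : ∀ {B D u₁ u₂ v₁ v₂ C} → D < B → v₁ ≤ D → v₂ ≤ D →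
  B * u₁ ≡ v₁ + C → B * u₂ ≡ v₂ + C → u₁ ≡ u₂
close-multiples {B@(suc _)} {D} {u₁} {u₂} {v₁} {v₂} {C} D<B v₁≤D v₂≤D e₁ e₂ =
  sym (proj₂ (euclid-unique (≤-<-trans v₁≤D D<B) (≤-<-trans v₂≤D D<B) crossed))
  where
  crossed : v₁ + u₂ * B ≡ v₂ + u₁ * B
  crossed = +-cancelʳ-≡ C _ _ (begin
    v₁ + u₂ * B + C   ≡⟨ cong (λ x → v₁ + x + C) (*-comm u₂ B) ⟩
    v₁ + B * u₂ + C   ≡⟨ cong (λ x → v₁ + x + C) e₂ ⟩
    v₁ + (v₂ + C) + C ≡⟨ swap v₁ v₂ C ⟩
    v₂ + (v₁ + C) + C ≡⟨ cong (λ x → v₂ + x + C) (sym e₁) ⟩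
    v₂ + B * u₁ + C   ≡⟨ cong (λ x → v₂ + x + C) (*-comm B u₁) ⟩
    v₂ + u₁ * B + C   ∎)
    where
    swap : ∀ x y c → x + (y + c) + c ≡ y + (x + c) + c
    swap = solve-∀

n<m^n : ∀ {m} n → 1 < m → n < m ^ n
n<m^n     zero    _   = s≤s z≤n
n<m^n {m} (suc n) 1<m = ≤-trans (s≤s (n<m^n n 1<m)) (^-monoʳ-< m 1<m (n<1+n n))

geomSum-closed : ∀ q m → geomSum (suc q) m * q + 1 ≡ suc q ^ m
geomSum-closed q zero    = refl
geomSum-closed q (suc m) = begin
  (G + x) * q + 1     ≡⟨ regroup G x q ⟩
  (G * q + 1) + x * q ≡⟨ cong (_+ x * q) (geomSum-closed q m) ⟩
  x + x * q           ≡⟨ collect x q ⟩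
  suc q * x           ∎
  where
  G = geomSum (suc q) m
  x = suc q ^ m
  regroup : ∀ G x q → (G + x) * q + 1 ≡ (G * q + 1) + x * q
  regroup = solve-∀
  collect : ∀ x q → x + x * q ≡ (1 + q) * x
  collect = solve-∀

partial-cong : ∀ b f g → (∀ i → f (suc i) ≡ g (suc i)) → ∀ j → partial b f j ≡ partial b g j
partial-cong b f g f≗g zero    = refl
partial-cong b f g f≗g (suc j) = cong₂ _+_ (cong (_* b) (partial-cong b f g f≗g j)) (f≗g j)

module LongDivision (b num D : ℕ) .{{_ : NonZero D}} (1<b : 1 < b) (d : ℕ → ℕ)
  (series : SeriesEquals b d num D) (nonterminating : ∀ K → ∃[ i ] (K < i × d i ≢ 0)) where

  P : ℕ → ℕ
  P = partial b d

  r : ℕ → ℕ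
  r k = num * b ^ k ∸ P k * D

  -- The truncation at k undershoots num / D by r k / (D * b^k), with
  -- 0 ≤ r k ≤ D (both bounds are the series condition at k).
  remainder-split : ∀ k → r k + P k * D ≡ num * b ^ k
  remainder-split k = m∸n+n≡m (proj₁ (series k))

  remainder-≤ : ∀ k → r k ≤ D
  remainder-≤ k = ≤-trans (∸-monoˡ-≤ (P k * D) upper) (≤-reflexive (m+n∸n≡m D (P k * D)))
    where
    last-multiple : ∀ x D → (x + 1) * D ≡ D + x * D
    last-multiple = solve-∀
    upper : num * b ^ k ≤ D + P k * D
    upper = subst (num * b ^ k ≤_) (last-multiple (P k) D) (proj₂ (series k))

  remainder-step : ∀ k → r (suc k) + d (suc k) * D ≡ b * r k
  remainder-step k = +-cancelʳ-≡ (P k * b * D) _ _ (begin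
    r (suc k) + d (suc k) * D + P k * b * D ≡⟨ regroup (r (suc k)) (d (suc k)) (P k * b) D ⟩
    r (suc k) + P (suc k) * D               ≡⟨ remainder-split (suc k) ⟩
    num * b ^ suc k                          ≡⟨ shuffle num b (b ^ k) ⟩
    b * (num * b ^ k)                        ≡⟨ cong (b *_) (sym (remainder-split k)) ⟩
    b * (r k + P k * D)                      ≡⟨ expand b (r k) (P k) D ⟩
    b * r k + P k * b * D                    ∎)
    where
    regroup : ∀ x y z D → x + y * D + z * D ≡ x + (z + y) * D
    regroup = solve-∀
    shuffle : ∀ n b x → n * (b * x) ≡ b * (n * x)
    shuffle = solve-∀
    expand : ∀ b x y D → b * (x + y * D) ≡ b * x + y * b * D
    expand = solve-∀

  zero-remainder-persists : ∀ k → r k ≡ 0 → ∀ j → r (j + k) ≡ 0 × d (suc (j + k)) ≡ 0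
  zero-remainder-persists k rk≡0 zero = rk≡0 , digit-zero k rk≡0
    where
    digit-zero : ∀ m → r m ≡ 0 → d (suc m) ≡ 0
    digit-zero m rm≡0 = m*n≡0⇒m≡0 (d (suc m)) D
      (m+n≡0⇒n≡0 (r (suc m)) (trans (remainder-step m) (trans (cong (b *_) rm≡0) (*-zeroʳ b))))
  zero-remainder-persists k rk≡0 (suc j) with zero-remainder-persists k rk≡0 j
  ... | r≡0 , _ = next , proj₂ (zero-remainder-persists (suc (j + k)) next zero)
    where
    next : r (suc (j + k)) ≡ 0
    next = m+n≡0⇒m≡0 _ (trans (remainder-step (j + k)) (trans (cong (b *_) r≡0) (*-zeroʳ b)))

  remainder-positive : ∀ k → 1 ≤ r k
  remainder-positive k with r k in rk≡
  ... | suc _ = s≤s z≤n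
  ... | zero with nonterminating k
  ... | i , k<i , di≢0 with m≤n⇒∃[o]m+o≡n k<i
  ... | j , refl = ⊥-elim (di≢0 (subst (λ x → d x ≡ 0) (cong suc (+-comm j k))
                     (proj₂ (zero-remainder-persists k rk≡ j))))

  remainder-determines-next : ∀ k k' → r k ≡ r k' → d (suc k) ≡ d (suc k') × r (suc k) ≡ r (suc k')
  remainder-determines-next k k' rk≡rk' with
    division-unique (remainder-positive (suc k)) (remainder-≤ (suc k))
      (remainder-positive (suc k')) (remainder-≤ (suc k'))
      (trans (remainder-step k) (trans (cong (b *_) rk≡rk') (sym (remainder-step k'))))
  ... | r≡ , d≡ = d≡ , r≡

  tail : ℕ → ℕ → ℕ
  tail k i = d (i + k)

  TailsAgree : ℕ → ℕ → Set
  TailsAgree k k' = ∀ i → tail k (suc i) ≡ tail k' (suc i)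

  remainder-shift : ∀ k j → b ^ j * r k ≡ r (j + k) + partial b (tail k) j * D
  remainder-shift k zero    = refl
  remainder-shift k (suc j) = begin
    b * b ^ j * r k                           ≡⟨ *-assoc b (b ^ j) (r k) ⟩
    b * (b ^ j * r k)                         ≡⟨ cong (b *_) (remainder-shift k j) ⟩
    b * (r (j + k) + Q * D)                   ≡⟨ distrib b (r (j + k)) Q D ⟩
    b * r (j + k) + Q * b * D                 ≡⟨ cong (_+ Q * b * D) (sym (remainder-step (j + k))) ⟩
    r (suc j + k) + d (suc j + k) * D + Q * b * D ≡⟨ regroup (r (suc j + k)) (d (suc j + k)) (Q * b) D ⟩
    r (suc j + k) + (Q * b + d (suc j + k)) * D ∎
    where
    Q = partial b (tail k) j
    distrib : ∀ b x y D → b * (x + y * D) ≡ b * x + y * b * D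
    distrib = solve-∀
    regroup : ∀ x y z D → x + y * D + z * D ≡ x + (z + y) * D
    regroup = solve-∀

  -- The tail of digits determines the remainder: after D more steps the
  -- remainders lie within D < b^D of a common value.
  tails-agree⇒remainders-equal : ∀ k k' → TailsAgree k k' → r k ≡ r k'
  tails-agree⇒remainders-equal k k' agree =
    close-multiples (n<m^n D 1<b) (remainder-≤ (D + k)) (remainder-≤ (D + k'))
      (remainder-shift k D)
      (trans (remainder-shift k' D) (cong (λ Q → r (D + k') + Q * D) (sym same-block)))
    where
    same-block : partial b (tail k) D ≡ partial b (tail k') D
    same-block = partial-cong b (tail k) (tail k') agree D

  remainders-equal⇒tails-agree : ∀ k k' → r k ≡ r k' → TailsAgree k k'
  remainders-equal⇒tails-agree k k' rk≡rk' i = proj₁ (remainder-determines-next (i + k) (i + k') (later i))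
    where
    later : ∀ i → r (i + k) ≡ r (i + k')
    later zero    = rk≡rk'
    later (suc i) = proj₂ (remainder-determines-next (i + k) (i + k') (later i))

  remainders-equal⇔tails-agree : ∀ k k' → r k ≡ r k' ⇔ TailsAgree k k'
  remainders-equal⇔tails-agree k k' =
    mk⇔ (remainders-equal⇒tails-agree k k') (tails-agree⇒remainders-equal k k')

  remainders-equal⇔divides : ∀ k m X → num * b ^ (k + m) ≡ X + num * b ^ k → r k ≡ r (k + m) ⇔ D ∣ X
  remainders-equal⇔divides k m X gap = mk⇔ to from
    where
    two-ways : r (k + m) + P (k + m) * D ≡ X + (r k + P k * D)
    two-ways = trans (remainder-split (k + m)) (trans gap (cong (X +_) (sym (remainder-split k))))
    to : r k ≡ r (k + m) → D ∣ X
    to r≡ = ∣m+n∣m⇒∣n D∣PkD+X (n∣m*n (P k))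
      where
      multiple : P (k + m) * D ≡ P k * D + X
      multiple = +-cancelˡ-≡ (r k) _ _ (begin
        r k + P (k + m) * D       ≡⟨ cong (_+ P (k + m) * D) r≡ ⟩
        r (k + m) + P (k + m) * D ≡⟨ two-ways ⟩
        X + (r k + P k * D)       ≡⟨ swap X (r k) (P k * D) ⟩
        r k + (P k * D + X)       ∎)
        where
        swap : ∀ x y z → x + (y + z) ≡ y + (z + x)
        swap = solve-∀
      D∣PkD+X : D ∣ P k * D + X
      D∣PkD+X = subst (D ∣_) multiple (n∣m*n (P (k + m)))
    from : D ∣ X → r k ≡ r (k + m)
    from (divides c X≡cD) = proj₁ (division-unique {a₁ = c + P k} {a₂ = P (k + m)} (remainder-positive k) (remainder-≤ k)
      (remainder-positive (k + m)) (remainder-≤ (k + m)) (begin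
        r k + (c + P k) * D   ≡⟨ regroup (r k) c (P k) D ⟩
        c * D + (r k + P k * D) ≡⟨ cong (_+ (r k + P k * D)) (sym X≡cD) ⟩
        X + (r k + P k * D)   ≡⟨ sym two-ways ⟩
        r (k + m) + P (k + m) * D ∎))
      where
      regroup : ∀ x c y D → x + (c + y) * D ≡ c * D + (x + y * D)
      regroup = solve-∀

Periodic : (ℕ → ℕ) → ℕ → ℕ → Set
Periodic d t s = ∀ i → d (t + suc i) ≡ d (t + suc i + s)

-- The theorem for p = q + 1 with q, n ≥ 1: then b = p^n, D = n * q and
-- b^(t+s) = b^t * G * q + b^t with G = Σ_{i<sn} p^i, so D ∣ b^t * G * q
-- iff n ∣ p^(nt) * G.
periodic⇔divisible : ∀ q n t s .{{_ : NonZero q}} .{{_ : NonZero n}} (d : ℕ → ℕ) →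
  IsBaseExpansion (suc q ^ n) 1 (n * q) d →
  Periodic d t s ⇔ n ∣ suc q ^ (n * t) * geomSum (suc q) (s * n)
periodic⇔divisible q@(suc _) n@(suc _) t s d (_ , nonterminating , series) =
  ⇔-trans (⇔-trans periodic⇔tails (⇔-sym (remainders-equal⇔tails-agree t (t + s))))
    (⇔-trans (remainders-equal⇔divides t s (b ^ t * G * q) gap) cancel-q)
  where
  p = suc q
  b = p ^ n
  G = geomSum p (s * n)
  instance
    D≢0 : NonZero (n * q)
    D≢0 = m*n≢0 n q
  1<b : 1 < b
  1<b = ≤-trans (s≤s (s≤s z≤n)) (subst (_≤ b) (*-identityʳ p) (^-monoʳ-≤ p {1} {n} (s≤s z≤n)))
  open LongDivision b 1 (n * q) 1<b d series nonterminating
  periodic⇔tails : Periodic d t s ⇔ TailsAgree t (t + s)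
  periodic⇔tails = mk⇔ (λ per i → subst₂ (λ x y → d x ≡ d y) (+-comm t (suc i)) (reindex i) (per i))
                       (λ agree i → subst₂ (λ x y → d x ≡ d y) (+-comm (suc i) t) (sym (reindex i)) (agree i))
    where
    reassociate : ∀ t i s → t + suc i + s ≡ suc i + (t + s)
    reassociate = solve-∀
    reindex : ∀ i → t + suc i + s ≡ suc i + (t + s)
    reindex i = reassociate t i s
  b^s : b ^ s ≡ G * q + 1
  b^s = begin
    (p ^ n) ^ s ≡⟨ ^-*-assoc p n s ⟩
    p ^ (n * s) ≡⟨ cong (p ^_) (*-comm n s) ⟩
    p ^ (s * n) ≡⟨ sym (geomSum-closed q (s * n)) ⟩
    G * q + 1   ∎
  gap : 1 * b ^ (t + s) ≡ b ^ t * G * q + 1 * b ^ t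
  gap = begin
    1 * b ^ (t + s)           ≡⟨ *-identityˡ (b ^ (t + s)) ⟩
    b ^ (t + s)               ≡⟨ ^-distribˡ-+-* b t s ⟩
    b ^ t * b ^ s             ≡⟨ cong (b ^ t *_) b^s ⟩
    b ^ t * (G * q + 1)       ≡⟨ expand (b ^ t) G q ⟩
    b ^ t * G * q + 1 * b ^ t ∎
    where
    expand : ∀ x G q → x * (G * q + 1) ≡ x * G * q + 1 * x
    expand = solve-∀
  cancel-q : n * q ∣ b ^ t * G * q ⇔ n ∣ p ^ (n * t) * G
  cancel-q = subst (λ x → n * q ∣ x * G * q ⇔ n ∣ p ^ (n * t) * G) (sym (^-*-assoc p n t))
    (mk⇔ (*-cancelʳ-∣ q) (*-monoˡ-∣ q))

lemma4 : (p n t s : ℕ) → Prime p → 1 ≤ n → 1 ≤ s →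
    (d : ℕ → ℕ) → IsBaseExpansion (p ^ n) (θnum p n) (θden p n) d →
    ((∀ i → d (t + suc i) ≡ d (t + suc i + s)) → n ∣ (p ^ (n * t) * geomSum p (s * n)))
    × (n ∣ (p ^ (n * t) * geomSum p (s * n)) → ∀ i → d (t + suc i) ≡ d (t + suc i + s))
lemma4 0 n t s p-prime = ⊥-elim (¬prime[0] p-prime)
lemma4 1 n t s p-prime = ⊥-elim (¬prime[1] p-prime)
lemma4 (2+ q) (suc n) t s _ _ _ d expansion =
  Equivalence.to equivalence , Equivalence.from equivalence
  where
  equivalence : Periodic d t s ⇔ suc n ∣ 2+ q ^ (suc n * t) * geomSum (2+ q) (s * suc n)
  equivalence = periodic⇔divisible (suc q) (suc n) t s d expansion
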